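{- Let $f:B\to A$ and $g:C\to A$ be two covers, and let $B\xleftarrow{p}U\xrightarrow{q}C$ be a pullback of $B\xrightarrow{f}A\xleftarrow{g}C$. If $h$ is a cover with $|{\rm Hom}(h,f)|=\deg f$ and $|{\rm Hom}(h,g)|=\deg g$, then $|{\rm Hom}(h,g\circ q\circ i)|=\deg(g\circ q\circ i)$ for each $i\in\Sigma(U)$.
   Context: Let $\mathbf C$ be a category and $\mathbf D$ a full subcategory of $\mathbf C$. For arrows $f,g$ of $\mathbf C$ with ${\rm cod}\,f={\rm cod}\,g$, ${\rm Hom}(g,f)$ denotes the collection of all arrows $h$ of $\mathbf C$ with $g=f\circ h$. Standing assumptions: (G1) every diagram $B\to A\leftarrow C$ in $\mathbf D$ has a pullback in $\mathbf C$. (G2) (I) pushouts exist in $\mathbf D$; (II) every arrow of $\mathbf D$ is epic; (III) every monic arrow of $\mathbf D$ is an isomorphism whose inverse is an arrow of $\mathbf D$. (G3) for every object $U$ of $\mathbf C$ there is a set $\Sigma(U)$ of arrows $i$ of $\mathbf C$ with ${\rm dom}\,i$ in $\mathbf D$ and ${\rm cod}\,i=U$ such that for every arrow $u$ of $\mathbf C$ with ${\rm dom}\,u$ in $\mathbf D$ and ${\rm cod}\,u=U$ there is exactly one $i\in\Sigma(U)$ with ${\rm Hom}(u,i)\neq\emptyset$. (G4) there is a function $\deg$ from the collection of arrows of $\mathbf C$ whose codomain lies in $\mathbf D$ to the positive integers such that (I) $\deg(g\circ f)=\deg g\cdot\deg f$ whenever $f,g,g\circ f$ all lie in this collection; (II)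 $\deg f=\sum_{i\in\Sigma({\rm dom}\,f)}\deg(f\circ i)$ for every such $f$; (III) if $B\xrightarrow{f}A\xleftarrow{g}C$ is a diagram in $\mathbf D$ with pullback $B\xleftarrow{p}U\xrightarrow{q}C$, then $\deg f=\deg q$ and $\deg g=\deg p$. A cover is an arrow of $\mathbf D$. -}

module Defs where

open import Level using (Level; _⊔_; suc)
open import Data.Nat using (ℕ; _*_; _≤_)
open import Data.Fin using (Fin)
open import Data.Product using (Σ; ∃; ∃-syntax; _×_; _,_; proj₁; proj₂)
open import Relation.Binary.PropositionalEquality using (_≡_)
open import Function.Bundles using (_↔_; Inverse)

open import Data.Nat using (zero; _+_) renaming (suc to sucℕ)
sumFin : (n : ℕ) → (Fin n → ℕ) → ℕ
sumFin zero w = 0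
sumFin (sucℕ n) w = w Fin.zero + sumFin n (λ k → w (Fin.suc k))
  where import Data.Fin as Fin

HasCard : ∀ {a} → Set a → ℕ → Set a
HasCard X n = X ↔ Fin n

-- "Σ_{x ∈ X} w x = t", where the sum of positive integers over X
-- is finite: X is finite and the sum along an enumeration equals t.
SumsTo : ∀ {a} (X : Set a) → (X → ℕ) → ℕ → Set a
SumsTo X w t = ∃[ n ] Σ (Fin n ↔ X) λ e → t ≡ sumFin n (λ k → w (Inverse.to e k))

record Category (o ℓ : Level) : Set (suc (o ⊔ ℓ)) where
  infixr 9 _∘_
  field
    Obj : Set o
    _⇒_ : Obj → Obj → Set ℓ
    id  : ∀ {A} → A ⇒ A
    _∘_ : ∀ {A B C} → B ⇒ C → A ⇒ B → A ⇒ C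
    identityˡ : ∀ {A B} (f : A ⇒ B) → id ∘ f ≡ f
    identityʳ : ∀ {A B} (f : A ⇒ B) → f ∘ id ≡ f
    assoc : ∀ {A B C D} (f : A ⇒ B) (g : B ⇒ C) (h : C ⇒ D) →
            (h ∘ g) ∘ f ≡ h ∘ (g ∘ f)
    hom-isSet : ∀ {A B} {f g : A ⇒ B} (p q : f ≡ g) → p ≡ q

  Hom : ∀ {X Y Z} → X ⇒ Z → Y ⇒ Z → Set ℓ
  Hom {X} {Y} g f = Σ (X ⇒ Y) λ h → g ≡ f ∘ h

  IsPullback : ∀ {A B C U} (f : B ⇒ A) (g : C ⇒ A) (p : U ⇒ B) (q : U ⇒ C) →
               Set (o ⊔ ℓ)
  IsPullback {A} {B} {C} {U} f g p q =
    (f ∘ p ≡ g ∘ q) ×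
    (∀ {W} (a : W ⇒ B) (b : W ⇒ C) → f ∘ a ≡ g ∘ b →
       Σ (W ⇒ U) λ u → (p ∘ u ≡ a) × (q ∘ u ≡ b) ×
         (∀ (v : W ⇒ U) → p ∘ v ≡ a → q ∘ v ≡ b → v ≡ u))

-- The whole setting: C, full subcategory D (given by a proposition-valued
-- predicate on objects), and the standing assumptions (G1)–(G4).
record Setting (o ℓ : Level) : Set (suc (o ⊔ ℓ)) where
  field
    𝐂 : Category o ℓ
  open Category 𝐂 public
  field
    InD : Obj → Set o
    InD-prop : ∀ {X} (a b : InD X) → a ≡ b

  MonicInD : ∀ {X Y} → X ⇒ Y → Set (o ⊔ ℓ)
  MonicInD {X} m = ∀ {Z} → InD Z → (a b : Z ⇒ X) → m ∘ a ≡ m ∘ b → a ≡ b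
  EpicInD : ∀ {X Y} → X ⇒ Y → Set (o ⊔ ℓ)
  EpicInD {Y = Y} e = ∀ {Z} → InD Z → (a b : Y ⇒ Z) → a ∘ e ≡ b ∘ e → a ≡ b

  IsPushoutInD : ∀ {A X Y P} (f : A ⇒ X) (g : A ⇒ Y) (i₁ : X ⇒ P) (i₂ : Y ⇒ P) →
                 Set (o ⊔ ℓ)
  IsPushoutInD {X = X} {Y} {P} f g i₁ i₂ =
    InD P × (i₁ ∘ f ≡ i₂ ∘ g) ×
    (∀ {W} → InD W → (a : X ⇒ W) (b : Y ⇒ W) → a ∘ f ≡ b ∘ g →
       Σ (P ⇒ W) λ u → (u ∘ i₁ ≡ a) × (u ∘ i₂ ≡ b) ×
         (∀ (v : P ⇒ W) → v ∘ i₁ ≡ a → v ∘ i₂ ≡ b → v ≡ u))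

  field
    G1 : ∀ {A B C} → InD A → InD B → InD C → (f : B ⇒ A) (g : C ⇒ A) →
         Σ Obj λ U → Σ (U ⇒ B) λ p → Σ (U ⇒ C) λ q → IsPullback f g p q
    G2-pushout : ∀ {A X Y} → InD A → InD X → InD Y → (f : A ⇒ X) (g : A ⇒ Y) →
         Σ Obj λ P → Σ (X ⇒ P) λ i₁ → Σ (Y ⇒ P) λ i₂ → IsPushoutInD f g i₁ i₂
    G2-epic : ∀ {X Y} → InD X → InD Y → (f : X ⇒ Y) → EpicInD f
    -- (G2)(III)  (the inverse is automatically in D since D is full)
    G2-monic : ∀ {X Y} → InD X → InD Y → (m : X ⇒ Y) → MonicInD m →
         Σ (Y ⇒ X) λ m⁻¹ → (m⁻¹ ∘ m ≡ id) × (m ∘ m⁻¹ ≡ id)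
    -- (G3): Σ(U) as an indexed family of arrows with domain in D
    Sig : Obj → Set (o ⊔ ℓ)
    sigDom : ∀ {U} → Sig U → Obj
    sigDom-InD : ∀ {U} (i : Sig U) → InD (sigDom i)
    sig : ∀ {U} (i : Sig U) → sigDom i ⇒ U
    G3 : ∀ {X U} → InD X → (u : X ⇒ U) →
         Σ (Sig U) λ i → Hom u (sig i) ×
           (∀ (j : Sig U) → Hom u (sig j) → j ≡ i)
    deg : ∀ {X Y} → InD Y → X ⇒ Y → ℕ
    deg-pos : ∀ {X Y} (dY : InD Y) (f : X ⇒ Y) → 1 ≤ deg dY f
    G4-I : ∀ {X Y Z} (dY : InD Y) (dZ : InD Z) (f : X ⇒ Y) (g : Y ⇒ Z) →
         deg dZ (g ∘ f) ≡ deg dZ g * deg dY f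
    G4-II : ∀ {X Y} (dY : InD Y) (f : X ⇒ Y) →
         SumsTo (Sig X) (λ i → deg dY (f ∘ sig i)) (deg dY f)
    G4-III : ∀ {A B C U} → InD A → InD B → InD C →
         (f : B ⇒ A) (g : C ⇒ A) (p : U ⇒ B) (q : U ⇒ C) → IsPullback f g p q →
         (∀ (dA : InD A) (dC : InD C) → deg dA f ≡ deg dC q) ×
         (∀ (dA : InD A) (dB : InD B) → deg dA g ≡ deg dB p)

-- By the pullback property Hom(h, g∘q) ≅ Hom(h,f) × Hom(h,g), which therefore has
-- deg f · deg g = deg(g∘q) = Σ_{i ∈ Σ(U)} deg(g∘q∘i) elements.  Each u ∈ Hom(h, g∘q) factors
-- through exactly one i ∈ Σ(U); composing with i maps Hom(h, g∘q∘i) onto the fibre of this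
-- classification over i, with a section, so the fibre is at most as large as Hom(h, g∘q∘i).
-- Conversely Hom(h,k) injects into Σ(W) for the pullback W of k along h: every element yields a
-- section of W → H, and two sections factoring through the same member of Σ(W) coincide because
-- split monos in D are isomorphisms.  So |Hom(h,k)| ≤ |Σ(W)| ≤ deg k.  The fibre sizes and the
-- degrees deg(g∘q∘i) have the same total, so all these inequalities are equalities.

module Submission where

open import Defs
open import Data.Bool using (if_then_else_)
open import Data.Empty using (⊥-elim)
open import Data.Nat using (ℕ; zero; suc; _+_; _*_; _≤_; z≤n)
open import Data.Nat.Properties
  using (+-0-commutativeMonoid; +-mono-≤; +-monoʳ-≤; +-cancelˡ-≡; +-cancelʳ-≤;
         ≤-antisym; ≤-trans; ≤⇒≯; *-comm)
open import Data.Fin using (Fin; zero; suc)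
open import Data.Fin.Properties using (_≟_; any?; +↔⊎; *↔×; injective⇒≤)
open import Data.Product using (Σ; ∃; ∃-syntax; _×_; _,_; proj₁; proj₂)
open import Data.Product.Function.NonDependent.Propositional using (_×-↔_)
open import Data.Sum using (_⊎_; inj₁; inj₂)
open import Data.Sum.Function.Propositional using (_⊎-↔_)
open import Algebra.Properties.CommutativeMonoid.Sum +-0-commutativeMonoid
  using (sum; sum-syntax; sum-cong-≗; sum-replicate-zero; ∑-comm)
open import Axiom.UniquenessOfIdentityProofs using (module Decidable⇒UIP)
open import Function using (_∘′_; Injective)
open import Function.Bundles
  using (_↔_; _↣_; _↪_; Inverse; Injection; RightInverse; mk↔ₛ′; mk↣; mk↪)
open import Function.Properties.Inverse using (↔-trans; ↔-sym; ↔⇒↣)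
open import Function.Construct.Composition using (_↣-∘_)
open import Relation.Nullary using (Dec; yes; no; does; contradiction; Irrelevant)
open import Relation.Unary using (Decidable)
open import Relation.Binary.PropositionalEquality
  using (_≡_; _≗_; refl; sym; trans; cong; cong₂; subst; module ≡-Reasoning)

open Inverse using (to; from; strictlyInverseˡ; strictlyInverseʳ)

sumFin≡∑ : ∀ n (w : Fin n → ℕ) → sumFin n w ≡ ∑[ j < n ] w j
sumFin≡∑ zero    w = refl
sumFin≡∑ (suc n) w = cong (w zero +_) (sumFin≡∑ n (w ∘′ suc))

∑-const-1 : ∀ n → ∑[ j < n ] 1 ≡ n
∑-const-1 zero    = refl
∑-const-1 (suc n) = cong suc (∑-const-1 n)

n≤∑ : ∀ {n} (w : Fin n → ℕ) → (∀ j → 1 ≤ w j) → n ≤ ∑[ j < n ] w j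
n≤∑ {zero}  w 1≤w = z≤n
n≤∑ {suc n} w 1≤w = +-mono-≤ (1≤w zero) (n≤∑ (w ∘′ suc) (λ j → 1≤w (suc j)))

∑-mono-≤ : ∀ {n} {a b : Fin n → ℕ} → (∀ j → a j ≤ b j) → sum a ≤ sum b
∑-mono-≤ {zero}  a≤b = z≤n
∑-mono-≤ {suc n} a≤b = +-mono-≤ (a≤b zero) (∑-mono-≤ (λ j → a≤b (suc j)))

+-mono-≤-≡⇒≡ : ∀ {w x y z} → w ≤ x → y ≤ z → w + y ≡ x + z → w ≡ x × y ≡ z
+-mono-≤-≡⇒≡ {w} {x} {y} {z} w≤x y≤z eq =
  w≡x , +-cancelˡ-≡ x y z (subst (λ v → v + y ≡ x + z) w≡x eq)
  where
  w≡x : w ≡ x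
  w≡x = ≤-antisym w≤x (+-cancelʳ-≤ z x w (subst (_≤ w + z) eq (+-monoʳ-≤ w y≤z)))

∑-mono-≤-≡⇒≗ : ∀ {n} {a b : Fin n → ℕ} → (∀ j → a j ≤ b j) → sum a ≡ sum b → a ≗ b
∑-mono-≤-≡⇒≗ {suc n} a≤b ∑a≡∑b
  with a₀≡b₀ , ∑a′≡∑b′ ← +-mono-≤-≡⇒≡ (a≤b zero) (∑-mono-≤ (λ j → a≤b (suc j))) ∑a≡∑b = λ where
    zero    → a₀≡b₀
    (suc j) → ∑-mono-≤-≡⇒≗ (λ j → a≤b (suc j)) ∑a′≡∑b′ j

indicator : ∀ {p} {P : Set p} → Dec P → ℕ
indicator P? = if does P? then 1 else 0

Irrelevant⇒↔indicator : ∀ {p} {P : Set p} → Irrelevant P → (P? : Dec P) → P ↔ Fin (indicator P?)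
Irrelevant⇒↔indicator irr (yes p) =
  mk↔ₛ′ (λ _ → zero) (λ _ → p) (λ { zero → refl }) (irr p)
Irrelevant⇒↔indicator irr (no ¬p) =
  mk↔ₛ′ (⊥-elim ∘′ ¬p) (λ ()) (λ ()) (λ p → ⊥-elim (¬p p))

Σ-Fin-suc↔⊎ : ∀ {p n} {P : Fin (suc n) → Set p} →
              Σ (Fin (suc n)) P ↔ (P zero ⊎ Σ (Fin n) (P ∘′ suc))
Σ-Fin-suc↔⊎ {P = P} = mk↔ₛ′ split join (λ { (inj₁ _) → refl ; (inj₂ _) → refl })
                                        (λ { (zero , _) → refl ; (suc _ , _) → refl })
  where
  split : Σ _ P → P zero ⊎ Σ _ (P ∘′ suc)
  split (zero  , p) = inj₁ p
  split (suc x , p) = inj₂ (x , p)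
  join : P zero ⊎ Σ _ (P ∘′ suc) → Σ _ P
  join (inj₁ p)       = zero , p
  join (inj₂ (x , p)) = suc x , p

Σ-Fin↔∑indicator : ∀ {p n} {P : Fin n → Set p} → (∀ x → Irrelevant (P x)) → (P? : Decidable P) →
                   Σ (Fin n) P ↔ Fin (∑[ x < n ] indicator (P? x))
Σ-Fin↔∑indicator {n = zero}  irr P? = mk↔ₛ′ (λ { (() , _) }) (λ ()) (λ ()) (λ { (() , _) })
Σ-Fin↔∑indicator {n = suc n} irr P? =
  ↔-trans Σ-Fin-suc↔⊎
    (↔-trans (Irrelevant⇒↔indicator (irr zero) (P? zero)
                ⊎-↔ Σ-Fin↔∑indicator (λ x → irr (suc x)) (λ x → P? (suc x)))
             (↔-sym +↔⊎))

Fin-irrelevant : ∀ {n} {x y : Fin n} → Irrelevant (x ≡ y)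
Fin-irrelevant = Decidable⇒UIP.≡-irrelevant _≟_

Fiber : ∀ {N n} → (Fin N → Fin n) → Fin n → Set
Fiber {N} φ j = Σ (Fin N) λ x → φ x ≡ j

Fiber-≡ : ∀ {N n} {φ : Fin N → Fin n} {j} {u v : Fiber φ j} → proj₁ u ≡ proj₁ v → u ≡ v
Fiber-≡ {u = x , p} {.x , q} refl = cong (x ,_) (Fin-irrelevant p q)

fiberSize : ∀ {N n} → (Fin N → Fin n) → Fin n → ℕ
fiberSize {N} φ j = ∑[ x < N ] indicator (φ x ≟ j)

Fiber↔fiberSize : ∀ {N n} (φ : Fin N → Fin n) j → HasCard (Fiber φ j) (fiberSize φ j)
Fiber↔fiberSize φ j = Σ-Fin↔∑indicator (λ _ → Fin-irrelevant) (λ x → φ x ≟ j)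

∑-indicator-≟ : ∀ {n} (a : Fin n) → ∑[ j < n ] indicator (a ≟ j) ≡ 1
∑-indicator-≟ {suc n} zero    = cong suc (sum-replicate-zero n)
∑-indicator-≟ {suc n} (suc a) = ∑-indicator-≟ a

∑-fiberSize : ∀ {N n} (φ : Fin N → Fin n) → ∑[ j < n ] fiberSize φ j ≡ N
∑-fiberSize {N} {n} φ = begin
  ∑[ j < n ] ∑[ x < N ] indicator (φ x ≟ j)  ≡⟨ sym (∑-comm (λ x j → indicator (φ x ≟ j))) ⟩
  ∑[ x < N ] ∑[ j < n ] indicator (φ x ≟ j)  ≡⟨ sum-cong-≗ (λ x → ∑-indicator-≟ (φ x)) ⟩
  ∑[ x < N ] 1                                ≡⟨ ∑-const-1 N ⟩
  N                                           ∎
  where open ≡-Reasoning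

injective⇒surjective : ∀ {m n} {F : Fin n → Fin m} → m ≤ n → Injective _≡_ _≡_ F →
                       ∀ y → ∃ λ x → F x ≡ y
injective⇒surjective {m} {n} {F} m≤n F-injective y with any? (λ x → F x ≟ y)
... | yes hit  = hit
... | no  miss = contradiction (injective⇒≤ extend-injective) (≤⇒≯ m≤n)
  where
  extend : Fin (suc n) → Fin m
  extend zero    = y
  extend (suc x) = F x
  extend-injective : Injective _≡_ _≡_ extend
  extend-injective {zero}  {zero}  _  = refl
  extend-injective {zero}  {suc x} eq = ⊥-elim (miss (x , sym eq))
  extend-injective {suc x} {zero}  eq = ⊥-elim (miss (x , eq))
  extend-injective {suc x} {suc _} eq = cong suc (F-injective eq)

module _ {a b} {X : Set a} {T : Set b} {t m : ℕ}
         (T↔Fin : T ↔ Fin t) (X↣Fin : X ↣ Fin m) (T↪X : T ↪ X) where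

  open RightInverse T↪X using () renaming (to to r; from to π; strictlyInverseʳ to π∘r)

  private
    ι : X → Fin m
    ι = Injection.to X↣Fin

    ι∘r∘from : Fin t → Fin m
    ι∘r∘from = ι ∘′ r ∘′ from T↔Fin

    ι∘r∘from-injective : Injective _≡_ _≡_ ι∘r∘from
    ι∘r∘from-injective {y} {y'} eq = begin
      y                            ≡⟨ sym (strictlyInverseˡ T↔Fin y) ⟩
      to T↔Fin (from T↔Fin y)      ≡⟨ cong (to T↔Fin) r-eq ⟩
      to T↔Fin (from T↔Fin y')     ≡⟨ strictlyInverseˡ T↔Fin y' ⟩
      y'                           ∎
      where
      open ≡-Reasoning
      r-eq : from T↔Fin y ≡ from T↔Fin y'
      r-eq = trans (sym (π∘r _)) (trans (cong π (Injection.injective X↣Fin eq)) (π∘r _))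

  retract-↣⇒≤ : t ≤ m
  retract-↣⇒≤ = injective⇒≤ ι∘r∘from-injective

  retract-↣-≥⇒↔ : m ≤ t → X ↔ T
  retract-↣-≥⇒↔ m≤t = mk↔ₛ′ π r π∘r r∘π
    where
    r∘π : ∀ x → r (π x) ≡ x
    r∘π x = r∘π-through (injective⇒surjective m≤t ι∘r∘from-injective (ι x))
      where
      r∘π-through : (∃ λ y → ι∘r∘from y ≡ ι x) → r (π x) ≡ x
      r∘π-through (y , ιry≡ιx) = begin
        r (π x)      ≡⟨ cong (r ∘′ π) (sym ry≡x) ⟩
        r (π (r y')) ≡⟨ cong r (π∘r y') ⟩
        r y'         ≡⟨ ry≡x ⟩
        x            ∎
        where
        open ≡-Reasoning
        y' : T
        y' = from T↔Fin y
        ry≡x : r y' ≡ x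
        ry≡x = Injection.injective X↣Fin ιry≡ιx

fiber-retracts-card : ∀ {a N n} (φ : Fin N → Fin n) (d : Fin n → ℕ) → N ≡ ∑[ j < n ] d j →
                      {X : Fin n → Set a} {m : Fin n → ℕ} → (∀ j → m j ≤ d j) →
                      (∀ j → X j ↣ Fin (m j)) → (∀ j → Fiber φ j ↪ X j) →
                      ∀ j → HasCard (X j) (d j)
fiber-retracts-card φ d N≡∑d {X} {m} m≤d X↣Fin Fiber↪X j =
  subst (HasCard (X j)) (fiberSize≡d j)
    (↔-trans (retract-↣-≥⇒↔ (Fiber↔fiberSize φ j) (X↣Fin j) (Fiber↪X j)
                            (subst (m j ≤_) (sym (fiberSize≡d j)) (m≤d j)))
             (Fiber↔fiberSize φ j))
  where
  fiberSize≡d : fiberSize φ ≗ d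
  fiberSize≡d = ∑-mono-≤-≡⇒≗
    (λ k → ≤-trans (retract-↣⇒≤ (Fiber↔fiberSize φ k) (X↣Fin k) (Fiber↪X k)) (m≤d k))
    (trans (∑-fiberSize φ) N≡∑d)

module CategoryProperties {o ℓ} (𝐂 : Category o ℓ) where
  open Category 𝐂
  open ≡-Reasoning

  Hom-≡ : ∀ {X Y Z} {g : X ⇒ Z} {f : Y ⇒ Z} {u v : Hom g f} → proj₁ u ≡ proj₁ v → u ≡ v
  Hom-≡ {u = x , p} {.x , q} refl = cong (x ,_) (hom-isSet p q)

  left-inverse≡right-inverse : ∀ {X Y} {t : X ⇒ Y} {e s : Y ⇒ X} →
                               e ∘ t ≡ id → t ∘ s ≡ id → e ≡ s
  left-inverse≡right-inverse {t = t} {e} {s} e∘t≡id t∘s≡id = begin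
    e            ≡⟨ sym (identityʳ e) ⟩
    e ∘ id       ≡⟨ cong (e ∘_) (sym t∘s≡id) ⟩
    e ∘ (t ∘ s)  ≡⟨ sym (assoc s t e) ⟩
    (e ∘ t) ∘ s  ≡⟨ cong (_∘ s) e∘t≡id ⟩
    id ∘ s       ≡⟨ identityˡ s ⟩
    s            ∎

  left-inverse⇒cancelˡ : ∀ {X Y Z} {t : X ⇒ Y} {e : Y ⇒ X} → e ∘ t ≡ id →
                         (a b : Z ⇒ X) → t ∘ a ≡ t ∘ b → a ≡ b
  left-inverse⇒cancelˡ {t = t} {e} e∘t≡id a b t∘a≡t∘b = begin
    a            ≡⟨ sym (identityˡ a) ⟩
    id ∘ a       ≡⟨ cong (_∘ a) (sym e∘t≡id) ⟩
    (e ∘ t) ∘ a  ≡⟨ assoc a t e ⟩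
    e ∘ (t ∘ a)  ≡⟨ cong (e ∘_) t∘a≡t∘b ⟩
    e ∘ (t ∘ b)  ≡⟨ sym (assoc b t e) ⟩
    (e ∘ t) ∘ b  ≡⟨ cong (_∘ b) e∘t≡id ⟩
    id ∘ b       ≡⟨ identityˡ b ⟩
    b            ∎

  Hom-pullback↔× : ∀ {A B C U H} {f : B ⇒ A} {g : C ⇒ A} {p : U ⇒ B} {q : U ⇒ C} →
                   IsPullback f g p q → (h : H ⇒ A) → Hom h (g ∘ q) ↔ (Hom h f × Hom h g)
  Hom-pullback↔× {f = f} {g} {p} {q} (f∘p≡g∘q , universal) h = mk↔ₛ′ legs gap legs∘gap gap∘legs
    where
    legs : Hom h (g ∘ q) → Hom h f × Hom h g
    legs (u , h≡gqu) = (p ∘ u , trans h≡gqu (trans (cong (_∘ u) (sym f∘p≡g∘q)) (assoc u p f)))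
                     , (q ∘ u , trans h≡gqu (assoc u q g))
    commutes : (ab : Hom h f × Hom h g) → f ∘ proj₁ (proj₁ ab) ≡ g ∘ proj₁ (proj₂ ab)
    commutes ((_ , h≡fa) , (_ , h≡gb)) = trans (sym h≡fa) h≡gb
    gap : Hom h f × Hom h g → Hom h (g ∘ q)
    gap ab@((a , _) , (b , h≡gb)) with u , _ , q∘u≡b , _ ← universal a b (commutes ab) =
      u , trans h≡gb (trans (cong (g ∘_) (sym q∘u≡b)) (sym (assoc u q g)))
    legs∘gap : ∀ ab → legs (gap ab) ≡ ab
    legs∘gap ab@((a , _) , (b , _)) with u , p∘u≡a , q∘u≡b , _ ← universal a b (commutes ab) =
      cong₂ _,_ (Hom-≡ p∘u≡a) (Hom-≡ q∘u≡b)
    gap∘legs : ∀ u → gap (legs u) ≡ u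
    gap∘legs u@(u₀ , _) with _ , _ , _ , unique ← universal (p ∘ u₀) (q ∘ u₀) (commutes (legs u)) =
      Hom-≡ (sym (unique u₀ refl refl))

module SettingProperties {o ℓ} (S : Setting o ℓ) where
  open Setting S
  open CategoryProperties 𝐂

  -- t is split monic, hence invertible by (G2)(III), so e is its inverse.
  section-unique : ∀ {X Y} → InD X → InD Y → {e : Y ⇒ X} {t t' : X ⇒ Y} →
                   e ∘ t ≡ id → e ∘ t' ≡ id → t ≡ t'
  section-unique dX dY {e} {t} e∘t≡id e∘t'≡id
    with t⁻¹ , _ , t∘t⁻¹≡id ← G2-monic dX dY t (λ _ → left-inverse⇒cancelˡ e∘t≡id) =
    left-inverse≡right-inverse t∘e≡id e∘t'≡id
    where
    t∘e≡id : t ∘ e ≡ id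
    t∘e≡id = subst (λ s → t ∘ s ≡ id) (sym (left-inverse≡right-inverse e∘t≡id t∘t⁻¹≡id)) t∘t⁻¹≡id

  class : ∀ {X U} → InD X → X ⇒ U → Sig U
  class dX u = proj₁ (G3 dX u)

  class-factor : ∀ {X U} (dX : InD X) (u : X ⇒ U) → Hom u (sig (class dX u))
  class-factor dX u = proj₁ (proj₂ (G3 dX u))

  class-unique : ∀ {X U} (dX : InD X) (u : X ⇒ U) (c : Sig U) → Hom u (sig c) → c ≡ class dX u
  class-unique dX u c = proj₂ (proj₂ (G3 dX u)) c

  sections-class-injective : ∀ {H W} (dH : InD H) {e : W ⇒ H} {s s' : H ⇒ W} →
                             e ∘ s ≡ id → e ∘ s' ≡ id → class dH s ≡ class dH s' → s ≡ s'
  sections-class-injective {W = W} dH {e} {s} {s'} e∘s≡id e∘s'≡id same-class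
    with t , s≡ct ← class-factor dH s
       | t' , s'≡ct' ← subst (λ c → Hom s' (sig c)) (sym same-class) (class-factor dH s') = begin
    s              ≡⟨ s≡ct ⟩
    sig c ∘ t      ≡⟨ cong (sig c ∘_) (section-unique dH (sigDom-InD c) (through s≡ct e∘s≡id)
                                                                         (through s'≡ct' e∘s'≡id)) ⟩
    sig c ∘ t'     ≡⟨ sym s'≡ct' ⟩
    s'             ∎
    where
    open ≡-Reasoning
    c : Sig W
    c = class dH s
    through : ∀ {r u} → r ≡ sig c ∘ u → e ∘ r ≡ id → (e ∘ sig c) ∘ u ≡ id
    through {r} {u} r≡cu e∘r≡id = trans (assoc u (sig c) e) (trans (cong (e ∘_) (sym r≡cu)) e∘r≡id)

  Hom↣Sig : ∀ {A H V W} (dH : InD H) {h : H ⇒ A} {k : V ⇒ A} {pW : W ⇒ V} {qW : W ⇒ H} →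
            IsPullback k h pW qW → Hom h k ↣ Sig W
  Hom↣Sig {H = H} {W = W} dH {h} {k} {pW} {qW} (_ , universal) =
    mk↣ λ {v} {v'} → classOfLift-injective v v'
    where
    lift : (v : Hom h k) → Σ (H ⇒ W) λ s → (pW ∘ s ≡ proj₁ v) × (qW ∘ s ≡ id)
    lift (v , h≡kv)
      with s , pW∘s≡v , qW∘s≡id , _ ← universal v id (trans (sym h≡kv) (sym (identityʳ h))) =
      s , pW∘s≡v , qW∘s≡id

    classOfLift : Hom h k → Sig W
    classOfLift v = class dH (proj₁ (lift v))

    classOfLift-injective : ∀ v v' → classOfLift v ≡ classOfLift v' → v ≡ v'
    classOfLift-injective v v' same-class = Hom-≡ (begin
      proj₁ v                 ≡⟨ sym (proj₁ (proj₂ (lift v))) ⟩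
      pW ∘ proj₁ (lift v)     ≡⟨ cong (pW ∘_) (sections-class-injective dH (proj₂ (proj₂ (lift v)))
                                                                           (proj₂ (proj₂ (lift v')))
                                                                           same-class) ⟩
      pW ∘ proj₁ (lift v')    ≡⟨ proj₁ (proj₂ (lift v')) ⟩
      proj₁ v'                ∎)
      where open ≡-Reasoning

  Sig-pullback↔Fin≤deg : ∀ {A H V W} (dA : InD A) (dH : InD H) (dV : InD V)
                         {h : H ⇒ A} {k : V ⇒ A} {pW : W ⇒ V} {qW : W ⇒ H} →
                         IsPullback k h pW qW → ∃[ m ] m ≤ deg dA k × (Sig W ↔ Fin m)
  Sig-pullback↔Fin≤deg dA dH dV {h} {k} {pW} {qW} pb
    with m , Fin↔Sig , deg≡sumFin ← G4-II dH qW = m , m≤deg , ↔-sym Fin↔Sig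
    where
    m≤deg : m ≤ deg dA k
    m≤deg = subst (m ≤_) (sym (trans (proj₁ (G4-III dA dV dH k h pW qW pb) dA dH)
                                      (trans deg≡sumFin (sumFin≡∑ m _))))
                  (n≤∑ _ (λ j → deg-pos dH _))

  Hom↣Fin≤deg : ∀ {A H V} (dA : InD A) (dH : InD H) (dV : InD V) (h : H ⇒ A) (k : V ⇒ A) →
                ∃[ m ] m ≤ deg dA k × (Hom h k ↣ Fin m)
  Hom↣Fin≤deg dA dH dV h k =
    let _ , _ , _ , pb = G1 dA dV dH k h
        m , m≤deg , Sig↔Fin = Sig-pullback↔Fin≤deg dA dH dV pb
    in  m , m≤deg , ↔⇒↣ Sig↔Fin ↣-∘ Hom↣Sig dH pb

  module _ {A H U} (dH : InD H) (h : H ⇒ A) (ℓ : U ⇒ A) where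

    ∘sig : (c : Sig U) → Hom h (ℓ ∘ sig c) → Hom h ℓ
    ∘sig c (v , h≡ℓcv) = sig c ∘ v , trans h≡ℓcv (assoc v (sig c) ℓ)

    class-∘sig : ∀ c v → class dH (proj₁ (∘sig c v)) ≡ c
    class-∘sig c (v , _) = sym (class-unique dH (sig c ∘ v) c (v , refl))

    factor : ∀ {c} (u : Hom h ℓ) → class dH (proj₁ u) ≡ c → Hom h (ℓ ∘ sig c)
    factor (u , h≡ℓu) refl with t , u≡ct ← class-factor dH u =
      t , trans h≡ℓu (trans (cong (ℓ ∘_) u≡ct) (sym (assoc t (sig (class dH u)) ℓ)))

    ∘sig-factor : ∀ {c} (u : Hom h ℓ) (class≡c : class dH (proj₁ u) ≡ c) →
                  ∘sig c (factor u class≡c) ≡ u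
    ∘sig-factor (u , _) refl = Hom-≡ (sym (proj₂ (class-factor dH u)))

    Fiber↪Hom : ∀ {N n} (Hom↔Fin : Hom h ℓ ↔ Fin N) (Fin↔Sig : Fin n ↔ Sig U) (j : Fin n) →
                Fiber (λ x → from Fin↔Sig (class dH (proj₁ (from Hom↔Fin x)))) j ↪
                Hom h (ℓ ∘ sig (to Fin↔Sig j))
    Fiber↪Hom {n = n} Hom↔Fin Fin↔Sig j =
      mk↪ {to = fiber→Hom} {from = Hom→fiber} λ { refl → Hom→fiber∘fiber→Hom _ }
      where
      c : Sig U
      c = to Fin↔Sig j
      index : Hom h ℓ → Fin n
      index u = from Fin↔Sig (class dH (proj₁ u))

      class≡c : (y : Fiber (index ∘′ from Hom↔Fin) j) →
                class dH (proj₁ (from Hom↔Fin (proj₁ y))) ≡ c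
      class≡c (_ , index≡j) = trans (sym (strictlyInverseˡ Fin↔Sig _)) (cong (to Fin↔Sig) index≡j)

      fiber→Hom : Fiber (index ∘′ from Hom↔Fin) j → Hom h (ℓ ∘ sig c)
      fiber→Hom y = factor (from Hom↔Fin (proj₁ y)) (class≡c y)

      Hom→fiber : Hom h (ℓ ∘ sig c) → Fiber (index ∘′ from Hom↔Fin) j
      Hom→fiber v = to Hom↔Fin (∘sig c v) , (begin
        index (from Hom↔Fin (to Hom↔Fin (∘sig c v)))  ≡⟨ cong index (strictlyInverseʳ Hom↔Fin _) ⟩
        from Fin↔Sig (class dH (proj₁ (∘sig c v)))    ≡⟨ cong (from Fin↔Sig) (class-∘sig c v) ⟩
        from Fin↔Sig (to Fin↔Sig j)                   ≡⟨ strictlyInverseʳ Fin↔Sig j ⟩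
        j                                             ∎)
        where open ≡-Reasoning

      Hom→fiber∘fiber→Hom : ∀ y → Hom→fiber (fiber→Hom y) ≡ y
      Hom→fiber∘fiber→Hom y = Fiber-≡
        (trans (cong (to Hom↔Fin) (∘sig-factor (from Hom↔Fin (proj₁ y)) (class≡c y)))
               (strictlyInverseˡ Hom↔Fin (proj₁ y)))

  Hom-∘sig-card : ∀ {A H U} (dA : InD A) (dH : InD H) (h : H ⇒ A) (ℓ : U ⇒ A) →
                  HasCard (Hom h ℓ) (deg dA ℓ) →
                  (i : Sig U) → HasCard (Hom h (ℓ ∘ sig i)) (deg dA (ℓ ∘ sig i))
  Hom-∘sig-card dA dH h ℓ Hom↔Fin i with n , Fin↔Sig , deg≡sumFin ← G4-II dA ℓ =
    subst (λ c → HasCard (Hom h (ℓ ∘ sig c)) (deg dA (ℓ ∘ sig c))) (strictlyInverseˡ Fin↔Sig i)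
      (fiber-retracts-card (λ x → from Fin↔Sig (class dH (proj₁ (from Hom↔Fin x)))) d
                           (trans deg≡sumFin (sumFin≡∑ n d))
                           (λ j → proj₁ (proj₂ (bound j))) (λ j → proj₂ (proj₂ (bound j)))
                           (Fiber↪Hom dH h ℓ Hom↔Fin Fin↔Sig) (from Fin↔Sig i))
    where
    d : Fin n → ℕ
    d j = deg dA (ℓ ∘ sig (to Fin↔Sig j))
    bound : ∀ j → ∃[ m ] m ≤ d j × (Hom h (ℓ ∘ sig (to Fin↔Sig j)) ↣ Fin m)
    bound j = Hom↣Fin≤deg dA dH (sigDom-InD (to Fin↔Sig j)) h (ℓ ∘ sig (to Fin↔Sig j))

  Hom-pullback-card : ∀ {A B C U H} (dA : InD A) (dB : InD B) (dC : InD C)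
                      {f : B ⇒ A} {g : C ⇒ A} {p : U ⇒ B} {q : U ⇒ C} → IsPullback f g p q →
                      (h : H ⇒ A) → HasCard (Hom h f) (deg dA f) → HasCard (Hom h g) (deg dA g) →
                      HasCard (Hom h (g ∘ q)) (deg dA (g ∘ q))
  Hom-pullback-card dA dB dC {f} {g} {p} {q} pb h Hom-f↔Fin Hom-g↔Fin =
    subst (HasCard (Hom h (g ∘ q))) deg-f*deg-g≡deg-g∘q
      (↔-trans (Hom-pullback↔× pb h) (↔-trans (Hom-f↔Fin ×-↔ Hom-g↔Fin) (↔-sym *↔×)))
    where
    open ≡-Reasoning
    deg-f*deg-g≡deg-g∘q : deg dA f * deg dA g ≡ deg dA (g ∘ q)
    deg-f*deg-g≡deg-g∘q = begin
      deg dA f * deg dA g  ≡⟨ *-comm (deg dA f) (deg dA g) ⟩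
      deg dA g * deg dA f  ≡⟨ cong (deg dA g *_) (proj₁ (G4-III dA dB dC f g p q pb) dA dC) ⟩
      deg dA g * deg dC q  ≡⟨ sym (G4-I dC dA q g) ⟩
      deg dA (g ∘ q)       ∎

lemma4p3 : ∀ {o ℓ} (S : Setting o ℓ) → let open Setting S in
    ∀ {A B C U H} (dA : InD A) (dB : InD B) (dC : InD C) (dH : InD H)
      (f : B ⇒ A) (g : C ⇒ A) (p : U ⇒ B) (q : U ⇒ C) →
      IsPullback f g p q →
      (h : H ⇒ A) →
      HasCard (Hom h f) (deg dA f) →
      HasCard (Hom h g) (deg dA g) →
      (i : Sig U) →
      HasCard (Hom h (g ∘ q ∘ sig i)) (deg dA (g ∘ q ∘ sig i))
lemma4p3 S dA dB dC dH f g p q pb h Hom-f↔Fin Hom-g↔Fin i =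
  subst (λ k → HasCard (Hom h k) (deg dA k)) (assoc (sig i) q g)
    (Hom-∘sig-card dA dH h (g ∘ q) (Hom-pullback-card dA dB dC pb h Hom-f↔Fin Hom-g↔Fin) i)
  where
  open Setting S
  open SettingProperties S
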